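{- Let $G$ be a $2$-vertex-connected undirected graph and $T$ a DFS tree of $G$ rooted at $r$. Let $u,v\neq r$ be vertices such that $v$ is an ancestor of $u$ and $M(v)$ is a descendant of $u$. Then $M(v)$ is a descendant of $M(u)$.
   Context: In the DFS tree $T$ with root $r$, every vertex is considered an ancestor and a descendant of itself; $T(v)$ is the subtree rooted at $v$. Edges of $G$ not in $T$ are back-edges; each joins a vertex to one of its ancestors. For a vertex $v\neq r$, $M(v)$ is the nearest common ancestor in $T$ of all descendants of $v$ that are joined by a back-edge to a proper ancestor of $v$ (this set is nonempty since $G$ is $2$-vertex-connected). -}

module Defs where

open import Data.Nat using (ℕ; _≤_)
open import Data.Fin using (Fin)
open import Data.Product using (_×_; Σ; ∃)
open import Data.Sum using (_⊎_)
open import Data.Unit using (⊤)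
open import Relation.Nullary using (¬_)
open import Relation.Binary.PropositionalEquality using (_≡_; _≢_)
open import Function using (_∘_)

record SimpleGraph {n : ℕ} (E : Fin n → Fin n → Set) : Set where
  field
    sym   : ∀ x y → E x y → E y x
    irrefl : ∀ x → ¬ E x x

data WalkIn {n : ℕ} (E : Fin n → Fin n → Set) (P : Fin n → Set) : Fin n → Fin n → Set where
  stop : ∀ {x} → P x → WalkIn E P x x
  step : ∀ {x w y} → P x → E x w → WalkIn E P w y → WalkIn E P x y

Connected : {n : ℕ} → (Fin n → Fin n → Set) → Set
Connected {n} E = ∀ (x y : Fin n) → WalkIn E (λ _ → ⊤) x y

record TwoVertexConnected {n : ℕ} (E : Fin n → Fin n → Set) : Set where
  field
    atLeast3  : 3 ≤ n
    connected : Connected E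
    noCut     : ∀ (z x y : Fin n) → x ≢ z → y ≢ z → WalkIn E (λ w → w ≢ z) x y

-- Rooted tree given by a parent function p with root r (convention p r ≡ r).
iter : {n : ℕ} → (Fin n → Fin n) → ℕ → Fin n → Fin n
iter p ℕ.zero x = x
iter p (ℕ.suc k) x = p (iter p k x)

-- Anc r p a x : a is an ancestor of x (reflexive: every vertex is its own ancestor).
data Anc {n : ℕ} (r : Fin n) (p : Fin n → Fin n) (a : Fin n) : Fin n → Set where
  here : Anc r p a a
  up   : ∀ {x} → x ≢ r → Anc r p a (p x) → Anc r p a x

ProperAnc : {n : ℕ} → Fin n → (Fin n → Fin n) → Fin n → Fin n → Set
ProperAnc r p a x = Anc r p a x × a ≢ x

record SpanningTree {n : ℕ} (E : Fin n → Fin n → Set) (r : Fin n) (p : Fin n → Fin n) : Set where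
  field
    rootParent : p r ≡ r
    treeEdges  : ∀ v → v ≢ r → E v (p v)
    reachRoot  : ∀ v → ∃ λ k → iter p k v ≡ r

-- DFS tree: a spanning tree such that every edge of G joins a vertex to
-- one of its ancestors (so every non-tree edge is a back-edge).
record IsDFSTree {n : ℕ} (E : Fin n → Fin n → Set) (r : Fin n) (p : Fin n → Fin n) : Set where
  field
    spanning : SpanningTree E r p
    ancestral : ∀ x y → E x y → Anc r p x y ⊎ Anc r p y x

TreeEdge : {n : ℕ} → Fin n → (Fin n → Fin n) → Fin n → Fin n → Set
TreeEdge r p x y = (y ≢ r × x ≡ p y) ⊎ (x ≢ r × y ≡ p x)

BackEdge : {n : ℕ} → (Fin n → Fin n → Set) → Fin n → (Fin n → Fin n) → Fin n → Fin n → Set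
BackEdge E r p x y = E x y × ¬ TreeEdge r p x y

InSetM : {n : ℕ} → (Fin n → Fin n → Set) → Fin n → (Fin n → Fin n) → Fin n → Fin n → Set
InSetM E r p v d = Anc r p v d × ∃ λ a → ProperAnc r p a v × BackEdge E r p d a

-- m is the nearest common ancestor of the set InSetM v, i.e. m = M(v).
IsM : {n : ℕ} → (Fin n → Fin n → Set) → Fin n → (Fin n → Fin n) → Fin n → Fin n → Set
IsM E r p v m =
  (∀ d → InSetM E r p v d → Anc r p m d) ×
  (∀ c → (∀ d → InSetM E r p v d → Anc r p c d) → Anc r p c m)

module Submission where

-- Let d be any vertex of the set defining M(v): a descendant of v
-- with a back-edge to a proper ancestor a of v.  Since M(v) is a common
-- ancestor of that set and u is an ancestor of M(v), d is a descendant of u;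
-- and a, a proper ancestor of v, is a proper ancestor of u because v is an
-- ancestor of u (ancestry is a partial order in a rooted tree).  Hence d also
-- lies in the set defining M(u), so M(u) is an ancestor of d.  Thus M(u) is a
-- common ancestor of the set defining M(v), and since M(v) is the NEAREST
-- common ancestor, M(u) is an ancestor of M(v).

open import Defs
open import Data.Nat using (ℕ; zero; suc)
open import Data.Fin using (Fin)
open import Data.Empty using (⊥-elim)
open import Data.Product using (_,_; ∃)
open import Relation.Binary.PropositionalEquality using (_≡_; _≢_; refl; subst; sym)

module _ {n : ℕ} {r : Fin n} {p : Fin n → Fin n} where

  ReachesRoot : Set
  ReachesRoot = ∀ x → ∃ λ k → iter p k x ≡ r

  anc-trans : ∀ {a b c} → Anc r p a b → Anc r p b c → Anc r p a c
  anc-trans ab here        = ab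
  anc-trans ab (up c≢r bc) = up c≢r (anc-trans ab bc)

  desc-nonroot : ∀ {a y} → Anc r p a y → a ≢ r → y ≢ r
  desc-nonroot here       a≢r = a≢r
  desc-nonroot (up y≢r _) _   = y≢r

  parent-closed : ∀ {a y} → Anc r p a (p a) → Anc r p a y → Anc r p a (p y)
  parent-closed a-pa here        = a-pa
  parent-closed _    (up _ a-py) = a-py

  iter-desc : ∀ {a} → Anc r p a (p a) → ∀ k → Anc r p a (iter p k a)
  iter-desc a-pa zero    = here
  iter-desc a-pa (suc k) = parent-closed a-pa (iter-desc a-pa k)

  -- When every vertex reaches the root, ancestry is antisymmetric: if v ≠ r
  -- had a proper ancestor a that were also its descendant, v would be an
  -- ancestor of p v, hence of all its iterated parents, including the root.
  anc-antisym : ReachesRoot →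
                ∀ {a v} → Anc r p a v → Anc r p v a → a ≡ v
  anc-antisym reach here _ = refl
  anc-antisym reach {v = v} (up v≢r a-pv) va with reach v
  ... | k , iter≡r =
    ⊥-elim (desc-nonroot (iter-desc (anc-trans va a-pv) k) v≢r iter≡r)

  properAnc-desc : ReachesRoot →
                   ∀ {a v u} → ProperAnc r p a v → Anc r p v u → ProperAnc r p a u
  properAnc-desc reach {v = v} (av , a≢v) vu =
    anc-trans av vu , λ a≡u → a≢v (anc-antisym reach av (subst (Anc r p v) (sym a≡u) vu))

  inSetM-desc : (E : Fin n → Fin n → Set) → ReachesRoot →
                ∀ {u v d} → Anc r p v u → Anc r p u d →
                InSetM E r p v d → InSetM E r p u d
  inSetM-desc E reach vu ud (_ , a , a-v , back) = ud , a , properAnc-desc reach a-v vu , back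

lemma4 : ∀ {n : ℕ} (E : Fin n → Fin n → Set) → SimpleGraph E → TwoVertexConnected E →
    (r : Fin n) (p : Fin n → Fin n) → IsDFSTree E r p →
    (u v Mu Mv : Fin n) → u ≢ r → v ≢ r →
    IsM E r p u Mu → IsM E r p v Mv →
    Anc r p v u → Anc r p u Mv →
    Anc r p Mu Mv
lemma4 E _ _ r p dfs u v Mu Mv _ _ (Mu-below , _) (Mv-below , Mv-nearest) vu uMv =
  Mv-nearest Mu Mu-below-setV
  where
    reach : ReachesRoot {r = r} {p = p}
    reach = SpanningTree.reachRoot (IsDFSTree.spanning dfs)

    Mu-below-setV : ∀ d → InSetM E r p v d → Anc r p Mu d
    Mu-below-setV d d∈V =
      Mu-below d (inSetM-desc E reach vu (anc-trans uMv (Mv-below d d∈V)) d∈V)
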